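{- A graph $H$ covers every pair $(i,j)$ of integers with $i,j\ge3$ if and only if $H$ is a linear forest.
   Context: Graphs are finite and simple. A linear forest is a disjoint union of paths. $C_r$: cycle on $r$ vertices. For $i,j\ge3$, $k\ge1$, the butterfly $B_{i,j,k}$ is obtained from the disjoint union $C_i+C_j$ by choosing a vertex $x$ of $C_i$ and $y$ of $C_j$ and adding a path with $k$ edges between $x$ and $y$. A graph $H$ covers the pair $(i,j)$ ($i,j\ge3$) if $H$ is isomorphic to an induced subgraph of $B_{i,j,N}$ where $N=2|V(H)|+1$. -}

module Defs where

open import Data.Nat using (ℕ; zero; suc; _+_; _*_; _∸_; _<_; _≤_; _≡ᵇ_)
open import Data.Bool using (if_then_else_)
open import Data.Fin using (Fin; toℕ)
open import Data.List using (List; []; _∷_)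
open import Data.Nat.ListAction using (sum)
open import Data.Product using (Σ; _×_; _,_; ∃)
open import Data.Sum using (_⊎_; inj₁; inj₂)
open import Relation.Nullary using (¬_)
open import Relation.Binary.PropositionalEquality using (_≡_; _≢_; refl) renaming (sym to ≡-sym)
open import Function.Definitions using (Injective; Bijective)
open import Function.Bundles using (_⇔_)

record Graph : Set₁ where
  field
    n      : ℕ
    Adj    : Fin n → Fin n → Set
    adjSym : ∀ {u v} → Adj u v → Adj v u
    irrefl : ∀ {u} → ¬ Adj u u
open Graph public

fromRel : (n : ℕ) → (ℕ → ℕ → Set) → Graph
fromRel n E = record
  { n      = n
  ; Adj    = λ u v → (toℕ u ≢ toℕ v) × (E (toℕ u) (toℕ v) ⊎ E (toℕ v) (toℕ u))
  ; adjSym = λ { (ne , inj₁ e) → (λ eq → ne (≡-sym eq)) , inj₂ e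
               ; (ne , inj₂ e) → (λ eq → ne (≡-sym eq)) , inj₁ e }
  ; irrefl = λ { (ne , _) → ne refl }
  }

_⊑_ : Graph → Graph → Set
H ⊑ G = Σ (Fin (n H) → Fin (n G)) λ f →
          Injective _≡_ _≡_ f ×
          (∀ u v → Adj H u v ⇔ Adj G (f u) (f v))

_≅_ : Graph → Graph → Set
H ≅ G = Σ (Fin (n H) → Fin (n G)) λ f →
          Bijective _≡_ _≡_ f ×
          (∀ u v → Adj H u v ⇔ Adj G (f u) (f v))

-- Vertices 0..i-1 : the cycle C_i (x = 0),
-- vertices i..i+j-1 : the cycle C_j (y = i),
-- vertices i+j..i+j+k-2 : internal vertices of the x–y path with k edges.

pathVertex : ℕ → ℕ → ℕ → ℕ → ℕ
pathVertex i j k zero    = 0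
pathVertex i j k (suc t) = if suc t ≡ᵇ k then i else i + j + t

data BEdge (i j k : ℕ) : ℕ → ℕ → Set where
  cycI      : ∀ u → suc u < i → BEdge i j k u (suc u)
  cycIclose : BEdge i j k (i ∸ 1) 0
  cycJ      : ∀ u → i ≤ u → suc u < i + j → BEdge i j k u (suc u)
  cycJclose : BEdge i j k (i + j ∸ 1) i
  pth       : ∀ t → t < k → BEdge i j k (pathVertex i j k t) (pathVertex i j k (suc t))

Butterfly : ℕ → ℕ → ℕ → Graph
Butterfly i j k = fromRel (i + j + k ∸ 1) (BEdge i j k)

Covers : Graph → ℕ → ℕ → Set
Covers H i j = H ⊑ Butterfly i j (2 * n H + 1)

-- Linear forests: disjoint unions of paths.
-- For a list of path orders ms = m₁ ∷ m₂ ∷ …, the graph on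
-- sum ms vertices whose consecutive blocks of sizes m₁, m₂, … induce paths.

data LEdge : List ℕ → ℕ → ℕ → Set where
  here  : ∀ {m ms u} → suc u < m → LEdge (m ∷ ms) u (suc u)
  there : ∀ {m ms u v} → LEdge ms u v → LEdge (m ∷ ms) (m + u) (m + v)

PathUnion : List ℕ → Graph
PathUnion ms = fromRel (sum ms) (LEdge ms)

LinearForest : Graph → Set
LinearForest H = ∃ λ ms → H ≅ PathUnion ms

module Submission where

open import Defs
open import Data.Nat using (ℕ; zero; suc; _+_; _*_; _∸_; _<_; _≤_; z≤n; s≤s; _≡ᵇ_; _<ᵇ_)
open import Data.Nat.Properties
open import Data.Bool using (Bool; true; false; T; not; if_then_else_)
open import Data.Bool.Properties using (not-involutive)
open import Data.Fin using (Fin; zero; suc; toℕ; fromℕ<; punchIn; punchOut)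
import Data.Fin.Properties as Fin
open import Data.Fin.Permutation using (Permutation; _⟨$⟩ʳ_; _⟨$⟩ˡ_; insert; insert-punchIn; inverseˡ; ↔⇒≡)
  renaming (id to idₚ)
open import Data.List using (List; []; _∷_)
open import Data.Nat.ListAction using (sum)
open import Data.Product using (Σ; ∃; _×_; _,_; proj₁; proj₂)
open import Data.Sum using (_⊎_; inj₁; inj₂) renaming (map to ⊎-map; swap to ⊎-swap)
open import Data.Empty using (⊥; ⊥-elim)
open import Relation.Nullary using (¬_; Dec; yes; no; contradiction)
open import Relation.Nullary.Decidable using (isYes; toWitness; fromWitness)
open import Relation.Binary.PropositionalEquality
open import Relation.Binary.Definitions using (tri<; tri≈; tri>)
open import Function.Base using (_∘_)
open import Function.Definitions using (Injective)
open import Function.Bundles using (_⇔_; mk⇔; mk⤖; Equivalence; Bijection)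
open import Function.Properties.Bijection using (⤖⇒↔)
open import Function.Properties.Inverse using (Inverse⇒Bijection)
open import Function.Construct.Composition using (_⇔-∘_)
open import Function.Construct.Symmetry using (⇔-sym)

-- Both directions pass through the infinite path on ℕ (`Line`): a graph is a
-- linear forest iff it is an induced subgraph of the line (`LineEmbedding`).
-- `spread` lays a path union out on the line, gaps separating its paths;
-- `scan` reads a subgraph of the line from left to right and cuts it into
-- maximal runs (path unions are described by their links, `joined`).
-- (⇐) A linear forest H lies on the line below 2|H|, hence in the interior of
-- the x–y path of B_{i,j,2|H|+1}, which is an induced path.
-- (⇒) The odd butterfly B_{4,4,2|H|+1} is bipartite, so H is two-coloured and
-- its copy in B_{3,3,2|H|+1} misses a vertex of each triangle.  B_{3,3,k} is a
-- path listed along the line plus one chord in each triangle; the listing is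
-- chosen so that each chord has an endpoint outside the copy of H, and the
-- listing then places H on the line.

Line : ℕ → ℕ → Set
Line x y = y ≡ suc x ⊎ x ≡ suc y

LinkAdj : (ℕ → Bool) → ℕ → ℕ → Set
LinkAdj ℓ x y = (y ≡ suc x × T (ℓ x)) ⊎ (x ≡ suc y × T (ℓ y))

record LineEmbedding (H : Graph) : Set where
  field
    pos           : Fin (n H) → ℕ
    pos-injective : Injective _≡_ _≡_ pos
    pos-adj       : ∀ u v → Adj H u v ⇔ Line (pos u) (pos v)

orient : ∀ {A B A′ B′ : Set} → A ⇔ A′ → B ⇔ B′ → (A ⊎ B) ⇔ (A′ ⊎ B′)
orient p q = mk⇔ (⊎-map (Equivalence.to p) (Equivalence.to q)) (⊎-map (Equivalence.from p) (Equivalence.from q))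

swap⇔ : ∀ {A B : Set} → (A ⊎ B) ⇔ (B ⊎ A)
swap⇔ = mk⇔ ⊎-swap ⊎-swap

Line-irrefl : ∀ {x} → ¬ Line x x
Line-irrefl (inj₁ eq) = 1+n≢n (sym eq)
Line-irrefl (inj₂ eq) = 1+n≢n (sym eq)

LinkAdj-irrefl : ∀ {ℓ x} → ¬ LinkAdj ℓ x x
LinkAdj-irrefl (inj₁ (eq , _)) = 1+n≢n (sym eq)
LinkAdj-irrefl (inj₂ (eq , _)) = 1+n≢n (sym eq)

Line-sym : ∀ {a b} → Line a b → Line b a
Line-sym = ⊎-swap

Line-shift : ∀ m {a b} → Line a b → Line (m + a) (m + b)
Line-shift m {a}     (inj₁ refl) = inj₁ (+-suc m a)
Line-shift m {b = b} (inj₂ refl) = inj₂ (+-suc m b)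

-- joined ms x: the vertices x and x + 1 of PathUnion ms lie on one path.
joined : List ℕ → ℕ → Bool
joined []                 x       = false
joined (zero ∷ ms)        x       = joined ms x
joined (suc zero ∷ ms)    zero    = false
joined (suc zero ∷ ms)    (suc x) = joined ms x
joined (suc (suc m) ∷ ms) zero    = true
joined (suc (suc m) ∷ ms) (suc x) = joined (suc m ∷ ms) x

joined-here : ∀ m ms u → suc u < m → T (joined (m ∷ ms) u)
joined-here (suc zero)    ms zero    (s≤s ())
joined-here (suc (suc m)) ms zero    _           = _
joined-here (suc (suc m)) ms (suc u) (s≤s 1+u<m) = joined-here (suc m) ms u 1+u<m

joined-skip : ∀ m ms u → joined (m ∷ ms) (m + u) ≡ joined ms u
joined-skip zero          ms u = refl
joined-skip (suc zero)    ms u = refl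
joined-skip (suc (suc m)) ms u = joined-skip (suc m) ms u

LEdge-joined : ∀ {ms x y} → LEdge ms x y → y ≡ suc x × T (joined ms x)
LEdge-joined (here {m} {ms} {u} 1+u<m) = refl , joined-here m ms u 1+u<m
LEdge-joined (there {m} {ms} {u} e) with LEdge-joined e
... | refl , link = +-suc m u , subst T (sym (joined-skip m ms u)) link

LEdge-grow : ∀ {m ms x y} → LEdge (m ∷ ms) x y → LEdge (suc m ∷ ms) (suc x) (suc y)
LEdge-grow (here 1+u<m) = here (s≤s 1+u<m)
LEdge-grow (there e)    = there e

joined-LEdge : ∀ ms x → T (joined ms x) → LEdge ms x (suc x)
joined-LEdge (zero ∷ ms)        x       link = there (joined-LEdge ms x link)
joined-LEdge (suc zero ∷ ms)    (suc x) link = there {m = 1} (joined-LEdge ms x link)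
joined-LEdge (suc (suc m) ∷ ms) zero    link = here (s≤s (s≤s z≤n))
joined-LEdge (suc (suc m) ∷ ms) (suc x) link = LEdge-grow (joined-LEdge (suc m ∷ ms) x link)

LEdge⇔joined : ∀ ms x y → LEdge ms x y ⇔ (y ≡ suc x × T (joined ms x))
LEdge⇔joined ms x y = mk⇔ LEdge-joined λ { (refl , link) → joined-LEdge ms x link }

pathUnion-adj : ∀ ms (a b : Fin (sum ms)) → Adj (PathUnion ms) a b ⇔ LinkAdj (joined ms) (toℕ a) (toℕ b)
pathUnion-adj ms a b = mk⇔ (λ { (_ , e) → Equivalence.to edges e })
                           (λ e → (λ a≡b → LinkAdj-irrefl {joined ms} (subst (LinkAdj (joined ms) (toℕ a)) (sym a≡b) e))
                                , Equivalence.from edges e)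
  where
  edges = orient (LEdge⇔joined ms (toℕ a) (toℕ b)) (LEdge⇔joined ms (toℕ b) (toℕ a))

-- Lay the link graph of ℓ out on the line, leaving a gap of one position
-- after every missing link, so that links become exactly the Line-edges.
spread : (ℕ → Bool) → ℕ → ℕ
spread ℓ zero    = zero
spread ℓ (suc x) = if ℓ x then suc (spread ℓ x) else suc (suc (spread ℓ x))

spread-step : ∀ ℓ x → spread ℓ x < spread ℓ (suc x)
spread-step ℓ x with ℓ x
... | true  = ≤-refl
... | false = n≤1+n _

spread-unit-step : ∀ ℓ x → spread ℓ (suc x) ≡ suc (spread ℓ x) → T (ℓ x)
spread-unit-step ℓ x eq with ℓ x
... | true  = _
... | false = ⊥-elim (1+n≢n (suc-injective eq))

spread-mono : ∀ ℓ {x y} → x < y → spread ℓ x < spread ℓ y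
spread-mono ℓ {x} {suc y} (s≤s x≤y) with m≤n⇒m<n∨m≡n x≤y
... | inj₁ x<y  = <-trans (spread-mono ℓ x<y) (spread-step ℓ y)
... | inj₂ refl = spread-step ℓ x

spread-mono-≤ : ∀ ℓ {x y} → x ≤ y → spread ℓ x ≤ spread ℓ y
spread-mono-≤ ℓ x≤y with m≤n⇒m<n∨m≡n x≤y
... | inj₁ x<y  = <⇒≤ (spread-mono ℓ x<y)
... | inj₂ refl = ≤-refl

spread-injective : ∀ ℓ → Injective _≡_ _≡_ (spread ℓ)
spread-injective ℓ {x} {y} eq with <-cmp x y
... | tri< x<y _ _ = ⊥-elim (<⇒≢ (spread-mono ℓ x<y) eq)
... | tri≈ _ x≡y _ = x≡y
... | tri> _ _ y<x = ⊥-elim (<⇒≢ (spread-mono ℓ y<x) (sym eq))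

spread-bound : ∀ ℓ x → spread ℓ x ≤ x + x
spread-bound ℓ zero    = z≤n
spread-bound ℓ (suc x) = begin
  spread ℓ (suc x)       ≤⟨ at-most-two ⟩
  suc (suc (spread ℓ x)) ≤⟨ s≤s (s≤s (spread-bound ℓ x)) ⟩
  suc (suc (x + x))      ≡⟨ cong suc (sym (+-suc x x)) ⟩
  suc x + suc x          ∎
  where
  open ≤-Reasoning
  at-most-two : spread ℓ (suc x) ≤ suc (suc (spread ℓ x))
  at-most-two with ℓ x
  ... | true  = n≤1+n _
  ... | false = ≤-refl

spread-edge : ∀ ℓ x y → spread ℓ y ≡ suc (spread ℓ x) ⇔ (y ≡ suc x × T (ℓ x))
spread-edge ℓ x y = mk⇔ forward λ { (refl , link) → backward link }
  where
  backward : T (ℓ x) → spread ℓ (suc x) ≡ suc (spread ℓ x)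
  backward link with ℓ x
  ... | true = refl
  forward : spread ℓ y ≡ suc (spread ℓ x) → y ≡ suc x × T (ℓ x)
  forward eq with <-cmp y (suc x)
  ... | tri< (s≤s y≤x) _ _ = ⊥-elim (1+n≰n (≤-trans (≤-reflexive (sym eq)) (spread-mono-≤ ℓ y≤x)))
  ... | tri≈ _ refl _      = refl , spread-unit-step ℓ x eq
  ... | tri> _ _ 1+x<y     = ⊥-elim (1+n≰n (≤-trans (≤-trans (s≤s (spread-step ℓ x)) (spread-mono ℓ 1+x<y))
                                                    (≤-reflexive eq)))

spread-line : ∀ ℓ x y → Line (spread ℓ x) (spread ℓ y) ⇔ LinkAdj ℓ x y
spread-line ℓ x y = orient (spread-edge ℓ x y) (spread-edge ℓ y x)

linearForest⇒lineEmbedding : ∀ H → LinearForest H →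
  Σ (LineEmbedding H) λ E → ∀ u → LineEmbedding.pos E u < n H + n H
linearForest⇒lineEmbedding H (ms , f , f-bijective , f-adj) = E , bound
  where
  ℓ = joined ms
  E : LineEmbedding H
  E = record
    { pos           = λ u → spread ℓ (toℕ (f u))
    ; pos-injective = λ eq → proj₁ f-bijective (Fin.toℕ-injective (spread-injective ℓ eq))
    ; pos-adj       = λ u v → ⇔-sym (spread-line ℓ _ _) ⇔-∘ (pathUnion-adj ms (f u) (f v) ⇔-∘ f-adj u v)
    }
  sum≡N : sum ms ≡ n H
  sum≡N = sym (↔⇒≡ (⤖⇒↔ (mk⤖ f-bijective)))
  bound : ∀ u → spread ℓ (toℕ (f u)) < n H + n H
  bound u = ≤-<-trans (spread-bound ℓ (toℕ (f u))) (+-mono-< w<N w<N)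
    where
    w<N : toℕ (f u) < n H
    w<N = subst (toℕ (f u) <_) sum≡N (Fin.toℕ<n (f u))

-- Reading an induced subgraph of the line from left to right.  `prepend b ms`
-- puts a new vertex 0 in front of PathUnion ms, joined to the old vertex 0 iff b.
prepend : Bool → List ℕ → List ℕ
prepend false ms           = 1 ∷ ms
prepend true  []           = 1 ∷ []
prepend true  (zero ∷ ms)  = prepend true ms
prepend true  (suc m ∷ ms) = suc (suc m) ∷ ms

sum-prepend : ∀ b ms → sum (prepend b ms) ≡ suc (sum ms)
sum-prepend false ms           = refl
sum-prepend true  []           = refl
sum-prepend true  (zero ∷ ms)  = sum-prepend true ms
sum-prepend true  (suc m ∷ ms) = refl

joined-prepend-suc : ∀ b ms x → joined (prepend b ms) (suc x) ≡ joined ms x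
joined-prepend-suc false ms           x = refl
joined-prepend-suc true  []           x = refl
joined-prepend-suc true  (zero ∷ ms)  x = joined-prepend-suc true ms x
joined-prepend-suc true  (suc m ∷ ms) x = refl

joined-prepend-zero : ∀ b ms → 0 < sum ms → T (joined (prepend b ms) 0) ⇔ T b
joined-prepend-zero false ms           _     = mk⇔ (λ ()) (λ ())
joined-prepend-zero true  (zero ∷ ms)  0<sum = joined-prepend-zero true ms 0<sum
joined-prepend-zero true  (suc m ∷ ms) _     = mk⇔ _ _

LinkAdj-shift : ∀ {ℓ ℓ′ : ℕ → Bool} → (∀ x → ℓ (suc x) ≡ ℓ′ x) →
                ∀ x y → LinkAdj ℓ (suc x) (suc y) ⇔ LinkAdj ℓ′ x y
LinkAdj-shift {ℓ} {ℓ′} ℓ≡ x y = orient (mk⇔ (shift x y) (unshift x y)) (mk⇔ (shift y x) (unshift y x))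
  where
  shift : ∀ x y → suc y ≡ suc (suc x) × T (ℓ (suc x)) → y ≡ suc x × T (ℓ′ x)
  shift x y (eq , link) = suc-injective eq , subst T (ℓ≡ x) link
  unshift : ∀ x y → y ≡ suc x × T (ℓ′ x) → suc y ≡ suc (suc x) × T (ℓ (suc x))
  unshift x y (eq , link) = cong suc eq , subst T (sym (ℓ≡ x)) link

LinkAdj-zero : ∀ ℓ y → LinkAdj ℓ 0 (suc y) ⇔ (y ≡ 0 × T (ℓ 0))
LinkAdj-zero ℓ y = mk⇔ (λ { (inj₁ (eq , link)) → suc-injective eq , link ; (inj₂ (() , _)) })
                       (λ { (eq , link) → inj₁ (cong suc eq , link) })

insert-self : ∀ {m n} i j (π : Permutation m n) → insert i j π ⟨$⟩ʳ i ≡ j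
insert-self i j π with i Fin.≟ i
... | yes _  = refl
... | no i≢i = contradiction refl i≢i

permutation-injective : ∀ {m n} (π : Permutation m n) → Injective _≡_ _≡_ (π ⟨$⟩ʳ_)
permutation-injective π eq = trans (sym (inverseˡ π)) (trans (cong (π ⟨$⟩ˡ_) eq) (inverseˡ π))

toℕ-subst : ∀ {m a b} (e : a ≡ b) (π : Permutation m a) u →
            toℕ (subst (Permutation m) e π ⟨$⟩ʳ u) ≡ toℕ (π ⟨$⟩ʳ u)
toℕ-subst refl π u = refl

data Split {n} (t : Fin (suc n)) : Fin (suc n) → Set where
  pivot : Split t t
  other : ∀ a → Split t (punchIn t a)

split : ∀ {n} (t u : Fin (suc n)) → Split t u
split t u with t Fin.≟ u
... | yes refl = pivot
... | no t≢u   = subst (Split t) (Fin.punchIn-punchOut t≢u) (other (punchOut t≢u))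

-- The result of scanning the values of g from L upwards: the vertices ordered
-- as a path union whose links are the Line-edges between values of g, starting
-- with the vertex of value L (if any).
record Scan {n} (g : Fin n → ℕ) (L : ℕ) : Set where
  field
    blocks      : List ℕ
    order       : Permutation n (sum blocks)
    order-adj   : ∀ u v → Line (g u) (g v) ⇔ LinkAdj (joined blocks) (toℕ (order ⟨$⟩ʳ u)) (toℕ (order ⟨$⟩ʳ v))
    order-first : ∀ u → g u ≡ L → toℕ (order ⟨$⟩ʳ u) ≡ 0

scan-empty : ∀ (g : Fin 0 → ℕ) L → Scan g L
scan-empty g L = record { blocks = [] ; order = idₚ ; order-adj = λ () ; order-first = λ () }

scan-skip : ∀ {n} {g : Fin n → ℕ} {L} → (∀ u → g u ≢ L) → Scan g (suc L) → Scan g L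
scan-skip none R = record { Scan R ; order-first = λ u eq → ⊥-elim (none u eq) }

-- The vertex t of value L is put in front of a scan of the other vertices from
-- L + 1; it is joined to the next vertex iff b, i.e. iff some vertex has value L + 1.
module ScanInsert {n} (g : Fin (suc n) → ℕ) (L : ℕ) (t : Fin (suc n))
                  (g-injective : Injective _≡_ _≡_ g) (gt≡L : g t ≡ L) (L≤g : ∀ u → L ≤ g u)
                  (R : Scan (λ a → g (punchIn t a)) (suc L))
                  (b : Bool) (b⇔next : T b ⇔ ∃ λ w → g (punchIn t w) ≡ suc L) where
  open Scan R renaming (blocks to blocks′; order to order′; order-adj to order′-adj; order-first to order′-first)

  g′ : Fin n → ℕ
  g′ a = g (punchIn t a)

  ℓ : ℕ → Bool
  ℓ = joined (prepend b blocks′)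

  position : Fin (suc n) → ℕ
  position u = toℕ (insert t zero order′ ⟨$⟩ʳ u)

  position-pivot : position t ≡ 0
  position-pivot = cong toℕ (insert-self t zero order′)

  position-other : ∀ a → position (punchIn t a) ≡ suc (toℕ (order′ ⟨$⟩ʳ a))
  position-other a = cong toℕ (insert-punchIn t zero order′ a)

  pivot-adj : ∀ a → Line L (g′ a) ⇔ LinkAdj ℓ 0 (suc (toℕ (order′ ⟨$⟩ʳ a)))
  pivot-adj a = ⇔-sym (LinkAdj-zero ℓ _) ⇔-∘ mk⇔ forward backward
    where
    link⇔b : T (ℓ 0) ⇔ T b
    link⇔b = joined-prepend-zero b blocks′ (≤-trans (s≤s z≤n) (Fin.toℕ<n (order′ ⟨$⟩ʳ a)))
    forward : Line L (g′ a) → toℕ (order′ ⟨$⟩ʳ a) ≡ 0 × T (ℓ 0)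
    forward (inj₁ g′a≡1+L) = order′-first a g′a≡1+L
                           , Equivalence.from link⇔b (Equivalence.from b⇔next (a , g′a≡1+L))
    forward (inj₂ L≡1+g′a) = ⊥-elim (1+n≰n (≤-trans (≤-reflexive (sym L≡1+g′a)) (L≤g (punchIn t a))))
    backward : toℕ (order′ ⟨$⟩ʳ a) ≡ 0 × T (ℓ 0) → Line L (g′ a)
    backward (first , link) with Equivalence.to b⇔next (Equivalence.to link⇔b link)
    ... | w , g′w≡1+L = inj₁ (subst (λ c → g′ c ≡ suc L) w≡a g′w≡1+L)
      where
      w≡a : w ≡ a
      w≡a = permutation-injective order′ (Fin.toℕ-injective (trans (order′-first w g′w≡1+L) (sym first)))

  adj : ∀ u v → Line (g u) (g v) ⇔ LinkAdj ℓ (position u) (position v)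
  adj u v with split t u | split t v
  ... | pivot   | pivot   = mk⇔ (⊥-elim ∘ Line-irrefl) (⊥-elim ∘ LinkAdj-irrefl {ℓ})
  ... | pivot   | other c rewrite gt≡L | position-pivot | position-other c = pivot-adj c
  ... | other a | pivot   rewrite gt≡L | position-pivot | position-other a = swap⇔ ⇔-∘ (pivot-adj a ⇔-∘ swap⇔)
  ... | other a | other c rewrite position-other a | position-other c =
    ⇔-sym (LinkAdj-shift {ℓ} (joined-prepend-suc b blocks′) _ _) ⇔-∘ order′-adj a c

  result : Scan g L
  result = record
    { blocks      = prepend b blocks′
    ; order       = order
    ; order-adj   = λ u v → subst₂ (λ x y → Line (g u) (g v) ⇔ LinkAdj ℓ x y)
                                   (sym (position≡ u)) (sym (position≡ v)) (adj u v)
    ; order-first = λ u gu≡L → trans (position≡ u)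
                                     (subst (λ w → position w ≡ 0) (g-injective (trans gt≡L (sym gu≡L))) position-pivot)
    }
    where
    order : Permutation (suc n) (sum (prepend b blocks′))
    order = subst (Permutation (suc n)) (sym (sum-prepend b blocks′)) (insert t zero order′)
    position≡ : ∀ u → toℕ (order ⟨$⟩ʳ u) ≡ position u
    position≡ = toℕ-subst (sym (sum-prepend b blocks′)) (insert t zero order′)

scan : ∀ d L {n} (g : Fin n → ℕ) → Injective _≡_ _≡_ g → (∀ u → L ≤ g u) → (∀ u → g u < d + L) → Scan g L
scan zero    L {zero}  g _ _   _   = scan-empty g L
scan zero    L {suc n} g _ L≤g g<L = ⊥-elim (<⇒≱ (g<L zero) (L≤g zero))
scan (suc d) L {n} g g-injective L≤g g<1+d+L with Fin.any? (λ u → g u ≟ L)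
... | no none = scan-skip (λ u eq → none (u , eq))
                  (scan d (suc L) g g-injective (λ u → ≤∧≢⇒< (L≤g u) (λ eq → none (u , sym eq)))
                        (λ u → subst (g u <_) (sym (+-suc d L)) (g<1+d+L u)))
scan (suc d) L {suc n} g g-injective L≤g g<1+d+L | yes (t , gt≡L) =
  ScanInsert.result g L t g-injective gt≡L L≤g R (isYes next?) (mk⇔ toWitness fromWitness)
  where
  g′ : Fin n → ℕ
  g′ a = g (punchIn t a)
  1+L≤g′ : ∀ a → suc L ≤ g′ a
  1+L≤g′ a = ≤∧≢⇒< (L≤g _) (λ L≡g′a → Fin.punchInᵢ≢i t a (g-injective (trans (sym L≡g′a) (sym gt≡L))))
  R : Scan g′ (suc L)
  R = scan d (suc L) g′ (Fin.punchIn-injective t _ _ ∘ g-injective) 1+L≤g′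
           (λ a → subst (g′ a <_) (sym (+-suc d L)) (g<1+d+L _))
  next? : Dec (∃ λ w → g′ w ≡ suc L)
  next? = Fin.any? (λ w → g′ w ≟ suc L)

bounded : ∀ {n} (f : Fin n → ℕ) → ∃ λ d → ∀ u → f u < d
bounded {zero}  f = 0 , λ ()
bounded {suc n} f with bounded (f ∘ suc)
... | d , f<d = suc (f zero) + d , λ { zero    → s≤s (m≤m+n (f zero) d)
                                     ; (suc u) → ≤-trans (f<d u) (m≤n+m d (suc (f zero))) }

lineEmbedding⇒linearForest : ∀ H → LineEmbedding H → LinearForest H
lineEmbedding⇒linearForest H E = blocks , (order ⟨$⟩ʳ_) , Bijection.bijective (Inverse⇒Bijection order) , adj
  where
  open LineEmbedding E
  d = proj₁ (bounded pos)
  open Scan (scan d 0 pos pos-injective (λ _ → z≤n) (λ u → subst (pos u <_) (sym (+-identityʳ d)) (proj₂ (bounded pos) u)))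
  adj : ∀ u v → Adj H u v ⇔ Adj (PathUnion blocks) (order ⟨$⟩ʳ u) (order ⟨$⟩ʳ v)
  adj u v = ⇔-sym (pathUnion-adj blocks _ _) ⇔-∘ (order-adj u v ⇔-∘ pos-adj u v)

pathVertex-inner : ∀ i j k s → suc s ≢ k → pathVertex i j k (suc s) ≡ i + j + s
pathVertex-inner i j k s 1+s≢k with suc s ≡ᵇ k in eq
... | true  = contradiction (≡ᵇ⇒≡ (suc s) k (subst T (sym eq) _)) 1+s≢k
... | false = refl

pathVertex-last : ∀ i j s → pathVertex i j (suc s) (suc s) ≡ i
pathVertex-last i j s with suc s ≡ᵇ suc s | ≡⇒≡ᵇ (suc s) (suc s) refl
... | true | _ = refl

interior-edge : ∀ {i j k x y} → 0 < j → BEdge i j k x y → i + j ≤ x → i + j ≤ y → y ≡ suc x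
interior-edge {i} {j} {k} 0<j = go
  where
  outside : ∀ {x} → x < i + j → i + j ≤ x → ⊥
  outside = <⇒≱
  i<i+j : i < i + j
  i<i+j = m<m+n i 0<j
  go : ∀ {x y} → BEdge i j k x y → i + j ≤ x → i + j ≤ y → y ≡ suc x
  go (cycI u 1+u<i)    le _ = ⊥-elim (outside (<-trans (n<1+n u) (<-≤-trans 1+u<i (m≤m+n i j))) le)
  go cycIclose         le _ = ⊥-elim (outside (≤-<-trans (m∸n≤m i 1) i<i+j) le)
  go (cycJ u _ 1+u<ij) le _ = ⊥-elim (outside (<-trans (n<1+n u) 1+u<ij) le)
  go cycJclose         le _ = ⊥-elim (outside (∸-monoʳ-< {o = 0} (s≤s z≤n) (<-≤-trans 0<j (m≤n+m j i))) le)
  go (pth zero _)      le _ = ⊥-elim (outside (<-≤-trans 0<j (m≤n+m j i)) le)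
  go (pth (suc s) _) le₁ le₂ with suc s ≟ k | suc (suc s) ≟ k
  ... | yes refl | _         = ⊥-elim (outside (≤-<-trans (≤-reflexive (pathVertex-last i j s)) i<i+j) le₁)
  ... | no _     | yes refl  = ⊥-elim (outside (≤-<-trans (≤-reflexive (pathVertex-last i j (suc s))) i<i+j) le₂)
  ... | no 1+s≢k | no 2+s≢k = begin
    pathVertex i j k (suc (suc s)) ≡⟨ pathVertex-inner i j k (suc s) 2+s≢k ⟩
    i + j + suc s                  ≡⟨ +-suc (i + j) s ⟩
    suc (i + j + s)                ≡⟨ cong suc (pathVertex-inner i j k s 1+s≢k) ⟨
    suc (pathVertex i j k (suc s)) ∎
    where open ≡-Reasoning

interior-step : ∀ {i j k} t → suc (suc t) < k → BEdge i j k (i + j + t) (i + j + suc t)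
interior-step {i} {j} {k} t 2+t<k =
  subst₂ (BEdge i j k) (pathVertex-inner i j k t (<⇒≢ 1+t<k)) (pathVertex-inner i j k (suc t) (<⇒≢ 2+t<k))
                       (pth (suc t) 1+t<k)
  where
  1+t<k = <-trans (n<1+n _) 2+t<k

interior-adj : ∀ {i j k} t t′ → 0 < j → suc t < k → suc t′ < k →
  ((i + j + t ≢ i + j + t′) × (BEdge i j k (i + j + t) (i + j + t′) ⊎ BEdge i j k (i + j + t′) (i + j + t)))
  ⇔ Line t t′
interior-adj {i} {j} {k} t t′ 0<j 1+t<k 1+t′<k =
  mk⇔ (λ { (_ , e) → ⊎-map successor successor e })
      (λ { (inj₁ refl) → distinct , inj₁ (interior-step t 1+t′<k)
         ; (inj₂ refl) → distinct ∘ sym , inj₂ (interior-step t′ 1+t<k) })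
  where
  successor : ∀ {s s′} → BEdge i j k (i + j + s) (i + j + s′) → s′ ≡ suc s
  successor {s} {s′} e = +-cancelˡ-≡ (i + j) s′ (suc s)
    (trans (interior-edge 0<j e (m≤m+n (i + j) s) (m≤m+n (i + j) s′)) (sym (+-suc (i + j) s)))
  distinct : ∀ {s} → i + j + s ≢ i + j + suc s
  distinct {s} eq = 1+n≢n (sym (+-cancelˡ-≡ (i + j) s (suc s) eq))

lineEmbedding⇒butterfly : ∀ H i j k → 0 < j → (E : LineEmbedding H) →
  (∀ u → suc (LineEmbedding.pos E u) < k) → H ⊑ Butterfly i j k
lineEmbedding⇒butterfly H i j k 0<j E 1+pos<k = embed , embed-injective , embed-adj
  where
  open LineEmbedding E
  interior-bound : ∀ {t k} → suc t < k → i + j + t < i + j + k ∸ 1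
  interior-bound {t} {suc k} 1+t<1+k =
    subst (i + j + t <_) (sym (cong (_∸ 1) (+-suc (i + j) k))) (+-monoʳ-< (i + j) (≤-pred 1+t<1+k))
  embed : Fin (n H) → Fin (n (Butterfly i j k))
  embed u = fromℕ< (interior-bound (1+pos<k u))
  toℕ-embed : ∀ u → toℕ (embed u) ≡ i + j + pos u
  toℕ-embed u = Fin.toℕ-fromℕ< (interior-bound (1+pos<k u))
  embed-injective : Injective _≡_ _≡_ embed
  embed-injective {u} {v} eq = pos-injective (+-cancelˡ-≡ (i + j) (pos u) (pos v)
    (trans (sym (toℕ-embed u)) (trans (cong toℕ eq) (toℕ-embed v))))
  embed-adj : ∀ u v → Adj H u v ⇔ Adj (Butterfly i j k) (embed u) (embed v)
  embed-adj u v =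
    subst₂ (λ x y → Adj H u v ⇔ ((x ≢ y) × (BEdge i j k x y ⊎ BEdge i j k y x)))
           (sym (toℕ-embed u)) (sym (toℕ-embed v))
           (⇔-sym (interior-adj (pos u) (pos v) 0<j (1+pos<k u) (1+pos<k v)) ⇔-∘ pos-adj u v)

-- A linear forest on N vertices covers every pair (i, j) with j > 0: spread
-- on the line below 2N, it fits into the 2N interior vertices of B_{i,j,2N+1}.
linearForest⇒covers : ∀ H → LinearForest H → ∀ i j → 0 < j → Covers H i j
linearForest⇒covers H lf i j 0<j = lineEmbedding⇒butterfly H i j (2 * N + 1) 0<j E fits
  where
  N = n H
  E = proj₁ (linearForest⇒lineEmbedding H lf)
  1+N+N≡2N+1 : suc (N + N) ≡ 2 * N + 1
  1+N+N≡2N+1 = trans (cong (λ m → suc (N + m)) (sym (+-identityʳ N))) (+-comm 1 (2 * N))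
  fits : ∀ u → suc (LineEmbedding.pos E u) < 2 * N + 1
  fits u = subst (suc (LineEmbedding.pos E u) <_) 1+N+N≡2N+1 (s≤s (proj₂ (linearForest⇒lineEmbedding H lf) u))

TwoColouring : Graph → Set
TwoColouring G = Σ (Fin (n G) → Bool) λ c → ∀ u v → Adj G u v → c u ≢ c v

colouring-induced : ∀ {H G} → H ⊑ G → TwoColouring G → TwoColouring H
colouring-induced (f , _ , f-adj) (c , c-proper) =
  (λ u → c (f u)) , λ u v a → c-proper (f u) (f v) (Equivalence.to (f-adj u v) a)

no-triangle : ∀ {G} → TwoColouring G → ∀ u v w → Adj G u v → Adj G v w → Adj G u w → ⊥
no-triangle (c , c-proper) u v w uv vw uw with c u | c v | c w | c-proper u v uv | c-proper v w vw | c-proper u w uw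
... | true  | true  | _     | ne | _  | _  = ne refl
... | false | false | _     | ne | _  | _  = ne refl
... | true  | false | true  | _  | _  | ne = ne refl
... | true  | false | false | _  | ne | _  = ne refl
... | false | true  | true  | _  | ne | _  = ne refl
... | false | true  | false | _  | _  | ne = ne refl

-- The colour classes of B_{4,4,k}, k odd, are given by parities: the first
-- cycle is coloured by parity, all later vertices by the opposite parity.
odd : ℕ → Bool
odd zero    = false
odd (suc m) = not (odd m)

odd-+2 : ∀ m → odd (2 + m) ≡ odd m
odd-+2 m = not-involutive (odd m)

odd-2n+1 : ∀ m → odd (2 * m + 1) ≡ true
odd-2n+1 m = trans (cong odd (+-comm (2 * m) 1)) (cong not (even-2n m))
  where
  even-2n : ∀ m → odd (2 * m) ≡ false
  even-2n zero    = refl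
  even-2n (suc m) = trans (cong (λ x → odd (suc x)) (+-suc m (m + 0))) (trans (odd-+2 (2 * m)) (even-2n m))

colour44 : ℕ → Bool
colour44 x = if x <ᵇ 4 then odd x else odd (suc x)

colour44-path : ∀ k t → odd k ≡ true → colour44 (pathVertex 4 4 k t) ≡ odd t
colour44-path k zero    _      = refl
colour44-path k (suc s) k-odd with suc s ≟ k
... | yes refl = trans (cong colour44 (pathVertex-last 4 4 s)) (sym k-odd)
... | no 1+s≢k = trans (cong colour44 (pathVertex-inner 4 4 k s 1+s≢k))
                       (trans (odd-+2 (7 + s)) (trans (odd-+2 (5 + s)) (trans (odd-+2 (3 + s)) (odd-+2 (suc s)))))

colour44-edge : ∀ k {x y} → odd k ≡ true → BEdge 4 4 k x y → colour44 y ≡ not (colour44 x)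
colour44-edge k _     (cycI u 1+u<4)      = first-cycle u 1+u<4
  where
  first-cycle : ∀ u → suc u < 4 → colour44 (suc u) ≡ not (colour44 u)
  first-cycle 0 _ = refl
  first-cycle 1 _ = refl
  first-cycle 2 _ = refl
  first-cycle (suc (suc (suc _))) (s≤s (s≤s (s≤s (s≤s ()))))
colour44-edge k _     cycIclose           = refl
colour44-edge k _     (cycJ u 4≤u 1+u<8)  = second-cycle u 4≤u 1+u<8
  where
  second-cycle : ∀ u → 4 ≤ u → suc u < 8 → colour44 (suc u) ≡ not (colour44 u)
  second-cycle 4 _ _ = refl
  second-cycle 5 _ _ = refl
  second-cycle 6 _ _ = refl
  second-cycle (suc (suc (suc (suc (suc (suc (suc _))))))) _ (s≤s (s≤s (s≤s (s≤s (s≤s (s≤s (s≤s (s≤s ()))))))))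
  second-cycle 0 () _
  second-cycle 1 (s≤s ()) _
  second-cycle 2 (s≤s (s≤s ())) _
  second-cycle 3 (s≤s (s≤s (s≤s ()))) _
colour44-edge k _     cycJclose           = refl
colour44-edge k k-odd (pth t _) = trans (colour44-path k (suc t) k-odd) (cong not (sym (colour44-path k t k-odd)))

butterfly44-colouring : ∀ k → odd k ≡ true → TwoColouring (Butterfly 4 4 k)
butterfly44-colouring k k-odd = (λ a → colour44 (toℕ a)) , proper
  where
  no-fixpoint : ∀ {c} → c ≢ not c
  no-fixpoint {true}  ()
  no-fixpoint {false} ()
  proper : ∀ a b → Adj (Butterfly 4 4 k) a b → colour44 (toℕ a) ≢ colour44 (toℕ b)
  proper a b (_ , inj₁ e) eq = no-fixpoint (trans eq (colour44-edge k k-odd e))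
  proper a b (_ , inj₂ e) eq = no-fixpoint (trans (sym eq) (colour44-edge k k-odd e))

slot : Bool → ℕ → ℕ
slot s 1 = if s then 2 else 1
slot s 2 = if s then 1 else 2
slot s d = d

slot-involutive : ∀ s d → d < 3 → slot s (slot s d) ≡ d
slot-involutive s     0 _ = refl
slot-involutive false 1 _ = refl
slot-involutive true  1 _ = refl
slot-involutive false 2 _ = refl
slot-involutive true  2 _ = refl
slot-involutive s (suc (suc (suc _))) (s≤s (s≤s (s≤s ())))

slot<3 : ∀ s d → d < 3 → slot s d < 3
slot<3 s     0 _ = s≤s z≤n
slot<3 false 1 _ = s≤s (s≤s z≤n)
slot<3 true  1 _ = s≤s (s≤s (s≤s z≤n))
slot<3 false 2 _ = s≤s (s≤s (s≤s z≤n))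
slot<3 true  2 _ = s≤s (s≤s z≤n)
slot<3 s (suc (suc (suc _))) (s≤s (s≤s (s≤s ())))

-- The listing of B_{3,3,k} along a line: the first triangle backwards
-- (its vertex 0 = x last), the interior of the x–y path, then the second
-- triangle (its vertex 3 = y first).  The parameters choose which
-- triangle vertex comes at the outer end of the listing.
listing : Bool → Bool → ℕ → ℕ → ℕ
listing sL sR k (suc (suc (suc (suc (suc (suc s)))))) = 3 + s
listing sL sR k (suc (suc (suc d)))                   = 2 + k + slot sR d
listing sL sR k d                                     = 2 ∸ slot sL d

Pair : ℕ → ℕ → ℕ → ℕ → Set
Pair a b x y = (x ≡ a × y ≡ b) ⊎ (x ≡ b × y ≡ a)

Pair-sym : ∀ {a b x y} → Pair a b x y → Pair a b y x
Pair-sym (inj₁ (x≡a , y≡b)) = inj₂ (y≡b , x≡a)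
Pair-sym (inj₂ (x≡b , y≡a)) = inj₁ (y≡a , x≡b)

slot-injective : ∀ s {u v} → u < 3 → v < 3 → slot s u ≡ slot s v → u ≡ v
slot-injective s {u} {v} u<3 v<3 eq =
  trans (sym (slot-involutive s u u<3)) (trans (cong (slot s) eq) (slot-involutive s v v<3))

slot-far≢0 : ∀ s → 0 ≢ slot s 2
slot-far≢0 false ()
slot-far≢0 true  ()

triangle-step : ∀ s u → suc u < 3 → Line (slot s u) (slot s (suc u)) ⊎ Pair 0 (slot s 2) u (suc u)
triangle-step false 0 _ = inj₁ (inj₁ refl)
triangle-step true  0 _ = inj₂ (inj₁ (refl , refl))
triangle-step false 1 _ = inj₁ (inj₁ refl)
triangle-step true  1 _ = inj₁ (inj₂ refl)
triangle-step s (suc (suc _)) (s≤s (s≤s (s≤s ())))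

triangle-close : ∀ s → Line (slot s 2) (slot s 0) ⊎ Pair 0 (slot s 2) 2 0
triangle-close false = inj₂ (inj₂ (refl , refl))
triangle-close true  = inj₁ (inj₂ refl)

Line-mirror : ∀ {a b} → a ≤ 2 → b ≤ 2 → Line a b → Line (2 ∸ a) (2 ∸ b)
Line-mirror {0} _ _ (inj₁ refl) = inj₂ refl
Line-mirror {1} _ _ (inj₁ refl) = inj₂ refl
Line-mirror {suc (suc a)} _ (s≤s (s≤s ())) (inj₁ refl)
Line-mirror {b = 0} _ _ (inj₂ refl) = inj₁ refl
Line-mirror {b = 1} _ _ (inj₂ refl) = inj₁ refl
Line-mirror {b = suc (suc b)} (s≤s (s≤s ())) _ (inj₂ refl)

first-triangle-adj : ∀ k u v → u < 3 → v < 3 → u ≢ v → BEdge 3 3 k u v ⊎ BEdge 3 3 k v u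
first-triangle-adj k 0 0 _ _ 0≢0 = ⊥-elim (0≢0 refl)
first-triangle-adj k 0 1 _ _ _   = inj₁ (cycI 0 (s≤s (s≤s z≤n)))
first-triangle-adj k 0 2 _ _ _   = inj₂ cycIclose
first-triangle-adj k 1 0 _ _ _   = inj₂ (cycI 0 (s≤s (s≤s z≤n)))
first-triangle-adj k 1 1 _ _ 1≢1 = ⊥-elim (1≢1 refl)
first-triangle-adj k 1 2 _ _ _   = inj₁ (cycI 1 (s≤s (s≤s (s≤s z≤n))))
first-triangle-adj k 2 0 _ _ _   = inj₁ cycIclose
first-triangle-adj k 2 1 _ _ _   = inj₂ (cycI 1 (s≤s (s≤s (s≤s z≤n))))
first-triangle-adj k 2 2 _ _ 2≢2 = ⊥-elim (2≢2 refl)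
first-triangle-adj k (suc (suc (suc _))) _ (s≤s (s≤s (s≤s ()))) _ _
first-triangle-adj k _ (suc (suc (suc _))) _ (s≤s (s≤s (s≤s ()))) _

second-triangle-adj : ∀ k u v → u < 3 → v < 3 → u ≢ v → BEdge 3 3 k (3 + u) (3 + v) ⊎ BEdge 3 3 k (3 + v) (3 + u)
second-triangle-adj k 0 0 _ _ 0≢0 = ⊥-elim (0≢0 refl)
second-triangle-adj k 0 1 _ _ _   = inj₁ (cycJ 3 ≤-refl (s≤s (s≤s (s≤s (s≤s (s≤s z≤n))))))
second-triangle-adj k 0 2 _ _ _   = inj₂ cycJclose
second-triangle-adj k 1 0 _ _ _   = inj₂ (cycJ 3 ≤-refl (s≤s (s≤s (s≤s (s≤s (s≤s z≤n))))))
second-triangle-adj k 1 1 _ _ 1≢1 = ⊥-elim (1≢1 refl)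
second-triangle-adj k 1 2 _ _ _   = inj₁ (cycJ 4 (n≤1+n 3) (s≤s (s≤s (s≤s (s≤s (s≤s (s≤s z≤n)))))))
second-triangle-adj k 2 0 _ _ _   = inj₁ cycJclose
second-triangle-adj k 2 1 _ _ _   = inj₂ (cycJ 4 (n≤1+n 3) (s≤s (s≤s (s≤s (s≤s (s≤s (s≤s z≤n)))))))
second-triangle-adj k 2 2 _ _ 2≢2 = ⊥-elim (2≢2 refl)
second-triangle-adj k (suc (suc (suc _))) _ (s≤s (s≤s (s≤s ()))) _ _
second-triangle-adj k _ (suc (suc (suc _))) _ (s≤s (s≤s (s≤s ()))) _

module Listing (sL sR : Bool) (q : ℕ) where
  k : ℕ
  k = suc q

  pos : ℕ → ℕ
  pos = listing sL sR k

  BEsym : ℕ → ℕ → Set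
  BEsym x y = BEdge 3 3 k x y ⊎ BEdge 3 3 k y x

  -- The two triangle edges that are not edges of the listing.
  Chord : ℕ → ℕ → Set
  Chord x y = Pair 0 (slot sL 2) x y ⊎ Pair 3 (3 + slot sR 2) x y

  Chord-sym : ∀ {x y} → Chord x y → Chord y x
  Chord-sym (inj₁ p) = inj₁ (Pair-sym p)
  Chord-sym (inj₂ p) = inj₂ (Pair-sym p)

  data Region : ℕ → Set where
    left  : ∀ d → d < 3 → Region d
    right : ∀ d → d < 3 → Region (3 + d)
    inner : ∀ s → suc s < k → Region (6 + s)

  region : ∀ x → x < 5 + k → Region x
  region 0 _ = left 0 (s≤s z≤n)
  region 1 _ = left 1 (s≤s (s≤s z≤n))
  region 2 _ = left 2 (s≤s (s≤s (s≤s z≤n)))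
  region 3 _ = right 0 (s≤s z≤n)
  region 4 _ = right 1 (s≤s (s≤s z≤n))
  region 5 _ = right 2 (s≤s (s≤s (s≤s z≤n)))
  region (suc (suc (suc (suc (suc (suc s)))))) (s≤s (s≤s (s≤s (s≤s (s≤s 2+s≤k))))) = inner s 2+s≤k

  pos-left : ∀ d → d < 3 → pos d ≡ 2 ∸ slot sL d
  pos-left 0 _ = refl
  pos-left 1 _ = refl
  pos-left 2 _ = refl
  pos-left (suc (suc (suc _))) (s≤s (s≤s (s≤s ())))

  pos-right : ∀ d → d < 3 → pos (3 + d) ≡ 2 + k + slot sR d
  pos-right 0 _ = refl
  pos-right 1 _ = refl
  pos-right 2 _ = refl
  pos-right (suc (suc (suc _))) (s≤s (s≤s (s≤s ())))

  left-recover : ∀ d → d < 3 → slot sL (2 ∸ pos d) ≡ d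
  left-recover d d<3 = begin
    slot sL (2 ∸ pos d)               ≡⟨ cong (λ p → slot sL (2 ∸ p)) (pos-left d d<3) ⟩
    slot sL (2 ∸ (2 ∸ slot sL d))     ≡⟨ cong (slot sL) (m∸[m∸n]≡n (≤-pred (slot<3 sL d d<3))) ⟩
    slot sL (slot sL d)               ≡⟨ slot-involutive sL d d<3 ⟩
    d                                 ∎
    where open ≡-Reasoning

  right-recover : ∀ d → d < 3 → slot sR (pos (3 + d) ∸ (2 + k)) ≡ d
  right-recover d d<3 = begin
    slot sR (pos (3 + d) ∸ (2 + k))          ≡⟨ cong (λ p → slot sR (p ∸ (2 + k))) (pos-right d d<3) ⟩
    slot sR (2 + k + slot sR d ∸ (2 + k))    ≡⟨ cong (slot sR) (m+n∸m≡n (2 + k) (slot sR d)) ⟩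
    slot sR (slot sR d)                      ≡⟨ slot-involutive sR d d<3 ⟩
    d                                        ∎
    where open ≡-Reasoning

  left<inner : ∀ d s → d < 3 → pos d < pos (6 + s)
  left<inner d s d<3 = s≤s (≤-trans (≤-reflexive (pos-left d d<3)) (≤-trans (m∸n≤m 2 (slot sL d)) (m≤m+n 2 s)))

  inner<right : ∀ s d → suc s < k → d < 3 → pos (6 + s) < pos (3 + d)
  inner<right s d 1+s<k d<3 = ≤-trans (+-monoʳ-≤ 2 1+s<k)
                                     (≤-trans (m≤m+n (2 + k) (slot sR d)) (≤-reflexive (sym (pos-right d d<3))))

  left<right : ∀ d d′ → d < 3 → d′ < 3 → pos d < pos (3 + d′)
  left<right d d′ d<3 d′<3 =
    ≤-trans (s≤s (≤-trans (≤-reflexive (pos-left d d<3)) (m∸n≤m 2 (slot sL d))))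
            (≤-trans (+-monoʳ-≤ 2 (s≤s (z≤n {q})))
                     (≤-trans (m≤m+n (2 + k) (slot sR d′)) (≤-reflexive (sym (pos-right d′ d′<3)))))

  pos-injective : ∀ x y → x < 5 + k → y < 5 + k → pos x ≡ pos y → x ≡ y
  pos-injective x y x< y< eq with region x x< | region y y<
  ... | left d d<3  | left d′ d′<3  = trans (sym (left-recover d d<3))
                                        (trans (cong (λ p → slot sL (2 ∸ p)) eq) (left-recover d′ d′<3))
  ... | right d d<3 | right d′ d′<3 = cong (3 +_) (trans (sym (right-recover d d<3))
                                        (trans (cong (λ p → slot sR (p ∸ (2 + k))) eq) (right-recover d′ d′<3)))
  ... | inner s _   | inner s′ _    = cong (6 +_) (+-cancelˡ-≡ 3 s s′ eq)
  ... | left d d<3  | inner s′ _    = ⊥-elim (<⇒≢ (left<inner d s′ d<3) eq)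
  ... | inner s _   | left d′ d′<3  = ⊥-elim (<⇒≢ (left<inner d′ s d′<3) (sym eq))
  ... | left d d<3  | right d′ d′<3 = ⊥-elim (<⇒≢ (left<right d d′ d<3 d′<3) eq)
  ... | right d d<3 | left d′ d′<3  = ⊥-elim (<⇒≢ (left<right d′ d d′<3 d<3) (sym eq))
  ... | inner s 1+s<k | right d′ d′<3 = ⊥-elim (<⇒≢ (inner<right s d′ 1+s<k d′<3) eq)
  ... | right d d<3 | inner s′ 1+s′<k = ⊥-elim (<⇒≢ (inner<right s′ d 1+s′<k d<3) (sym eq))

  pos-bound : ∀ x → x < 5 + k → pos x < 5 + k
  pos-bound x x< with region x x<
  ... | left d d<3    = ≤-<-trans (≤-trans (≤-reflexive (pos-left d d<3)) (m∸n≤m 2 (slot sL d))) (m<m+n 2 (s≤s z≤n))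
  ... | right d d<3   = subst (_< 5 + k) (sym (pos-right d d<3))
                          (subst (2 + k + slot sR d <_) (+-comm (2 + k) 3) (+-monoʳ-< (2 + k) (slot<3 sR d d<3)))
  ... | inner s 1+s<k = <-trans (+-monoʳ-< 2 1+s<k) (+-monoˡ-< k {2} {5} (s≤s (s≤s (s≤s z≤n))))

  pos-path : ∀ t → t ≤ k → pos (pathVertex 3 3 k t) ≡ 2 + t
  pos-path zero    _ = refl
  pos-path (suc s) _ with suc s ≟ k
  ... | yes refl = trans (cong pos (pathVertex-last 3 3 q)) (+-identityʳ (2 + k))
  ... | no 1+s≢k = cong pos (pathVertex-inner 3 3 k s 1+s≢k)

  path-bound : ∀ t → t ≤ k → pathVertex 3 3 k t < 5 + k
  path-bound zero    _ = s≤s z≤n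
  path-bound (suc s) 1+s≤k with suc s ≟ k
  ... | yes refl = subst (_< 5 + k) (sym (pathVertex-last 3 3 q)) (s≤s (s≤s (s≤s (s≤s z≤n))))
  ... | no 1+s≢k = subst (_< 5 + k) (sym (pathVertex-inner 3 3 k s 1+s≢k))
                     (+-monoʳ-< 5 (≤∧≢⇒< 1+s≤k 1+s≢k))

  first-triangle-listing : ∀ {u v} → u < 3 → v < 3 →
    Line (slot sL u) (slot sL v) ⊎ Pair 0 (slot sL 2) u v → Line (pos u) (pos v) ⊎ Chord u v
  first-triangle-listing {u} {v} u<3 v<3 (inj₁ line) =
    inj₁ (subst₂ Line (sym (pos-left u u<3)) (sym (pos-left v v<3))
                 (Line-mirror (≤-pred (slot<3 sL u u<3)) (≤-pred (slot<3 sL v v<3)) line))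
  first-triangle-listing _ _ (inj₂ chord) = inj₂ (inj₁ chord)

  second-triangle-listing : ∀ {u v} → u < 3 → v < 3 →
    Line (slot sR u) (slot sR v) ⊎ Pair 0 (slot sR 2) u v → Line (pos (3 + u)) (pos (3 + v)) ⊎ Chord (3 + u) (3 + v)
  second-triangle-listing {u} {v} u<3 v<3 (inj₁ line) =
    inj₁ (subst₂ Line (sym (pos-right u u<3)) (sym (pos-right v v<3)) (Line-shift (2 + k) line))
  second-triangle-listing _ _ (inj₂ (inj₁ (refl , refl))) = inj₂ (inj₂ (inj₁ (refl , refl)))
  second-triangle-listing _ _ (inj₂ (inj₂ (refl , refl))) = inj₂ (inj₂ (inj₂ (refl , refl)))

  edge-listing : ∀ {x y} → BEdge 3 3 k x y → Line (pos x) (pos y) ⊎ Chord x y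
  edge-listing (cycI u 1+u<3)     = first-triangle-listing (<-trans (n<1+n u) 1+u<3) 1+u<3 (triangle-step sL u 1+u<3)
  edge-listing cycIclose          = first-triangle-listing (n<1+n 2) (s≤s z≤n) (triangle-close sL)
  edge-listing (cycJ u 3≤u 1+u<6) = second-triangle-step u 3≤u 1+u<6
    where
    second-triangle-step : ∀ u → 3 ≤ u → suc u < 6 → Line (pos u) (pos (suc u)) ⊎ Chord u (suc u)
    second-triangle-step (suc (suc (suc d))) _ (s≤s (s≤s (s≤s 1+d<3))) =
      second-triangle-listing (<-trans (n<1+n d) 1+d<3) 1+d<3 (triangle-step sR d 1+d<3)
    second-triangle-step 0 () _
    second-triangle-step 1 (s≤s ()) _
    second-triangle-step 2 (s≤s (s≤s ())) _
  edge-listing cycJclose          = second-triangle-listing (n<1+n 2) (s≤s z≤n) (triangle-close sR)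
  edge-listing (pth t t<k)        =
    inj₁ (inj₁ (trans (pos-path (suc t) t<k) (cong suc (sym (pos-path t (<⇒≤ t<k))))))

  chord-edge : ∀ {x y} → Chord x y → BEsym x y
  chord-edge (inj₁ (inj₁ (refl , refl))) = first-triangle-adj k 0 _ (s≤s z≤n) (slot<3 sL 2 ≤-refl) (slot-far≢0 sL)
  chord-edge (inj₁ (inj₂ (refl , refl))) = first-triangle-adj k _ 0 (slot<3 sL 2 ≤-refl) (s≤s z≤n) (slot-far≢0 sL ∘ sym)
  chord-edge (inj₂ (inj₁ (refl , refl))) = second-triangle-adj k 0 _ (s≤s z≤n) (slot<3 sR 2 ≤-refl) (slot-far≢0 sR)
  chord-edge (inj₂ (inj₂ (refl , refl))) = second-triangle-adj k _ 0 (slot<3 sR 2 ≤-refl) (s≤s z≤n) (slot-far≢0 sR ∘ sym)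

  record Step (p : ℕ) : Set where
    field
      from to    : ℕ
      from-range : from < 5 + k
      to-range   : to < 5 + k
      pos-from   : pos from ≡ p
      pos-to     : pos to ≡ suc p
      edge       : BEsym from to

  first-triangle-step : ∀ p → p < 2 → Step p
  first-triangle-step p p<2 = record
    { from = slot sL (2 ∸ p) ; to = slot sL (1 ∸ p)
    ; from-range = <-≤-trans from<3 (m≤m+n 3 (2 + k))
    ; to-range = <-≤-trans to<3 (m≤m+n 3 (2 + k))
    ; pos-from = listed (2 ∸ p) (m∸n<3 2 p ≤-refl) (m∸[m∸n]≡n (<⇒≤ p<2))
    ; pos-to = listed (1 ∸ p) (m∸n<3 1 p (n≤1+n 1)) (m∸[m∸n]≡n p<2)
    ; edge = first-triangle-adj k _ _ from<3 to<3
                                (distinct p p<2 ∘ slot-injective sL (m∸n<3 2 p ≤-refl) (m∸n<3 1 p (n≤1+n 1)))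
    }
    where
    m∸n<3 : ∀ m n → m ≤ 2 → m ∸ n < 3
    m∸n<3 m n m≤2 = s≤s (≤-trans (m∸n≤m m n) m≤2)
    from<3 = slot<3 sL (2 ∸ p) (m∸n<3 2 p ≤-refl)
    to<3 = slot<3 sL (1 ∸ p) (m∸n<3 1 p (n≤1+n 1))
    listed : ∀ o {p} → o < 3 → 2 ∸ o ≡ p → pos (slot sL o) ≡ p
    listed o o<3 2∸o≡p = trans (pos-left _ (slot<3 sL o o<3)) (trans (cong (2 ∸_) (slot-involutive sL o o<3)) 2∸o≡p)
    distinct : ∀ p → p < 2 → 2 ∸ p ≢ 1 ∸ p
    distinct 0 _ ()
    distinct 1 _ ()
    distinct (suc (suc _)) (s≤s (s≤s ()))

  second-triangle-step : ∀ e → e < 2 → Step (2 + k + e)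
  second-triangle-step e e<2 = record
    { from = 3 + slot sR e ; to = 3 + slot sR (suc e)
    ; from-range = in-range e<3
    ; to-range = in-range (s≤s e<2)
    ; pos-from = listed e<3
    ; pos-to = trans (listed (s≤s e<2)) (+-suc (2 + k) e)
    ; edge = second-triangle-adj k _ _ (slot<3 sR e e<3) (slot<3 sR (suc e) (s≤s e<2))
                                 (1+n≢n ∘ sym ∘ slot-injective sR e<3 (s≤s e<2))
    }
    where
    e<3 : e < 3
    e<3 = <-trans e<2 (n<1+n 2)
    in-range : ∀ {o} → o < 3 → 3 + slot sR o < 5 + k
    in-range o<3 = +-monoʳ-< 3 (<-≤-trans (slot<3 sR _ o<3) (m≤m+n 3 q))
    listed : ∀ {o} → o < 3 → pos (3 + slot sR o) ≡ 2 + k + o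
    listed {o} o<3 = trans (pos-right _ (slot<3 sR o o<3)) (cong (2 + k +_) (slot-involutive sR o o<3))

  path-step : ∀ t → t < k → Step (2 + t)
  path-step t t<k = record
    { from = pathVertex 3 3 k t ; to = pathVertex 3 3 k (suc t)
    ; from-range = path-bound t (<⇒≤ t<k) ; to-range = path-bound (suc t) t<k
    ; pos-from = pos-path t (<⇒≤ t<k) ; pos-to = pos-path (suc t) t<k
    ; edge = inj₁ (pth t t<k)
    }

  walk : ∀ p → suc p < 5 + k → Step p
  walk 0             _ = first-triangle-step 0 (s≤s z≤n)
  walk 1             _ = first-triangle-step 1 (s≤s (s≤s z≤n))
  walk (suc (suc t)) (s≤s (s≤s (s≤s t<2+k))) with <-cmp t k
  ... | tri< t<k _ _ = path-step t t<k
  ... | tri≈ _ refl _ = subst Step (+-identityʳ (2 + k)) (second-triangle-step 0 (s≤s z≤n))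
  ... | tri> _ _ k<t with ≤-antisym (≤-pred t<2+k) k<t
  ...   | refl = subst Step (trans (+-suc (2 + k) 0) (cong suc (+-identityʳ (2 + k)))) (second-triangle-step 1 (s≤s (s≤s z≤n)))

  listing-adj : ∀ x y → x < 5 + k → y < 5 + k → BEsym x y ⇔ (Line (pos x) (pos y) ⊎ Chord x y)
  listing-adj x y x< y< = mk⇔ forward backward
    where
    along : ∀ x y → x < 5 + k → y < 5 + k → pos y ≡ suc (pos x) → BEsym x y
    along x y x< y< py≡1+px = subst₂ BEsym from≡x to≡y edge
      where
      open Step (walk (pos x) (subst (_< 5 + k) py≡1+px (pos-bound y y<)))
      from≡x = pos-injective from x from-range x< pos-from
      to≡y   = pos-injective to y to-range y< (trans pos-to (sym py≡1+px))
    forward : BEsym x y → Line (pos x) (pos y) ⊎ Chord x y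
    forward (inj₁ e) = edge-listing e
    forward (inj₂ e) = ⊎-map Line-sym Chord-sym (edge-listing e)
    backward : Line (pos x) (pos y) ⊎ Chord x y → BEsym x y
    backward (inj₁ (inj₁ py≡1+px)) = along x y x< y< py≡1+px
    backward (inj₁ (inj₂ px≡1+py)) = ⊎-swap (along y x y< x< px≡1+py)
    backward (inj₂ chord)          = chord-edge chord

  BEsym-irrefl : ∀ {x} → ¬ BEsym x x
  BEsym-irrefl (inj₁ e) = loopless (edge-listing e)
    where
    loopless : ∀ {x} → ¬ (Line (pos x) (pos x) ⊎ Chord x x)
    loopless (inj₁ line) = Line-irrefl line
    loopless (inj₂ (inj₁ (inj₁ (refl , x≡far)))) = slot-far≢0 sL x≡far
    loopless (inj₂ (inj₁ (inj₂ (x≡far , refl)))) = slot-far≢0 sL x≡far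
    loopless (inj₂ (inj₂ (inj₁ (refl , x≡far)))) = slot-far≢0 sR (+-cancelˡ-≡ 3 0 _ x≡far)
    loopless (inj₂ (inj₂ (inj₂ (x≡far , refl)))) = slot-far≢0 sR (+-cancelˡ-≡ 3 0 _ x≡far)
  BEsym-irrefl (inj₂ e) = BEsym-irrefl (inj₁ e)

  chordless⇒lineEmbedding : ∀ H → (emb : H ⊑ Butterfly 3 3 k) →
    (∀ u v → ¬ Chord (toℕ (proj₁ emb u)) (toℕ (proj₁ emb v))) → LineEmbedding H
  chordless⇒lineEmbedding H (f , f-injective , f-adj) chordless = record
    { pos           = λ u → pos (toℕ (f u))
    ; pos-injective = λ {u} {v} eq → f-injective (Fin.toℕ-injective
                        (pos-injective _ _ (Fin.toℕ<n (f u)) (Fin.toℕ<n (f v)) eq))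
    ; pos-adj       = λ u v → no-chord u v ⇔-∘ (listing-adj _ _ (Fin.toℕ<n (f u)) (Fin.toℕ<n (f v))
                                            ⇔-∘ (loopless ⇔-∘ f-adj u v))
    }
    where
    loopless : ∀ {x y} → ((x ≢ y) × BEsym x y) ⇔ BEsym x y
    loopless = mk⇔ proj₂ λ e → (λ { refl → BEsym-irrefl e }) , e
    no-chord : ∀ u v → (Line (pos (toℕ (f u))) (pos (toℕ (f v))) ⊎ Chord (toℕ (f u)) (toℕ (f v)))
                       ⇔ Line (pos (toℕ (f u))) (pos (toℕ (f v)))
    no-chord u v = mk⇔ (λ { (inj₁ line) → line ; (inj₂ chord) → ⊥-elim (chordless u v chord) }) inj₁

Hit : ∀ {m N} → (Fin m → Fin N) → ℕ → Set
Hit f x = ∃ λ u → toℕ (f u) ≡ x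

Hit? : ∀ {m N} (f : Fin m → Fin N) x → Dec (Hit f x)
Hit? f x = Fin.any? (λ u → toℕ (f u) ≟ x)

triangle-missed : ∀ {H k} → TwoColouring H → ((f , _) : H ⊑ Butterfly 3 3 k) →
  (T : ℕ → ℕ) → (∀ {d d′} → T d ≡ T d′ → d ≡ d′) →
  (∀ d d′ → d < 3 → d′ < 3 → d ≢ d′ → BEdge 3 3 k (T d) (T d′) ⊎ BEdge 3 3 k (T d′) (T d)) →
  ¬ (Hit f (T 0) × Hit f (T 1) × Hit f (T 2))
triangle-missed {H} {k} colouring (f , _ , f-adj) T T-injective T-adj ((u₀ , e₀) , (u₁ , e₁) , (u₂ , e₂)) =
  no-triangle {H} colouring u₀ u₁ u₂
    (adj e₀ e₁ 0<3 1<3 (λ ())) (adj e₁ e₂ 1<3 2<3 (λ ())) (adj e₀ e₂ 0<3 2<3 (λ ()))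
  where
  0<3 = s≤s z≤n
  1<3 = s≤s (s≤s z≤n)
  2<3 = s≤s (s≤s (s≤s z≤n))
  adj : ∀ {u v d d′} → toℕ (f u) ≡ T d → toℕ (f v) ≡ T d′ → d < 3 → d′ < 3 → d ≢ d′ → Adj H u v
  adj {u} {v} eu ev d<3 d′<3 d≢d′ = Equivalence.from (f-adj u v)
    ( (λ eq → d≢d′ (T-injective (trans (sym eu) (trans eq ev))))
    , subst₂ (λ x y → BEdge 3 3 k x y ⊎ BEdge 3 3 k y x) (sym eu) (sym ev) (T-adj _ _ d<3 d′<3 d≢d′))

avoid-chord : (P : ℕ → Set) → (∀ d → Dec (P d)) → ¬ (P 0 × P 1 × P 2) → Σ Bool λ s → ¬ (P 0 × P (slot s 2))
avoid-chord P P? not-all with P? 1 | P? 2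
... | no ¬P1 | _      = true  , λ { (_ , P1) → ¬P1 P1 }
... | yes _  | no ¬P2 = false , λ { (_ , P2) → ¬P2 P2 }
... | yes P1 | yes P2 = false , λ { (P0 , _) → not-all (P0 , P1 , P2) }

-- A graph on N vertices covering (3,3) and (4,4) is an induced subgraph of the
-- line: B_{4,4,2N+1} two-colours it, so its copy in B_{3,3,2N+1} misses a vertex
-- of each triangle, and the listing is chosen to avoid both chords.
covers⇒lineEmbedding : ∀ H → Covers H 3 3 → Covers H 4 4 → LineEmbedding H
covers⇒lineEmbedding H cov33 cov44 = Listing.chordless⇒lineEmbedding sL sR q H emb chordless
  where
  N = n H
  q = 2 * N
  colouring : TwoColouring H
  colouring = colouring-induced {H} {Butterfly 4 4 (2 * N + 1)} cov44 (butterfly44-colouring (2 * N + 1) (odd-2n+1 N))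
  emb : H ⊑ Butterfly 3 3 (suc q)
  emb = subst (λ k → H ⊑ Butterfly 3 3 k) (+-comm (2 * N) 1) cov33
  f = proj₁ emb
  left-choice = avoid-chord (Hit f) (Hit? f)
                  (triangle-missed {H} {suc q} colouring emb (λ d → d) (λ eq → eq) (first-triangle-adj (suc q)))
  right-choice = avoid-chord (Hit f ∘ (3 +_)) (Hit? f ∘ (3 +_))
                   (triangle-missed {H} {suc q} colouring emb (3 +_) (+-cancelˡ-≡ 3 _ _) (second-triangle-adj (suc q)))
  sL = proj₁ left-choice
  sR = proj₁ right-choice
  chordless : ∀ u v → ¬ Listing.Chord sL sR q (toℕ (f u)) (toℕ (f v))
  chordless u v (inj₁ (inj₁ (e₀ , e))) = proj₂ left-choice ((u , e₀) , (v , e))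
  chordless u v (inj₁ (inj₂ (e , e₀))) = proj₂ left-choice ((v , e₀) , (u , e))
  chordless u v (inj₂ (inj₁ (e₀ , e))) = proj₂ right-choice ((u , e₀) , (v , e))
  chordless u v (inj₂ (inj₂ (e , e₀))) = proj₂ right-choice ((v , e₀) , (u , e))

lemma6 : (H : Graph) →
    ((i j : ℕ) → 3 ≤ i → 3 ≤ j → Covers H i j) ⇔ LinearForest H
lemma6 H = mk⇔ covers⇒linearForest linearForest⇒covers-all
  where
  covers⇒linearForest : ((i j : ℕ) → 3 ≤ i → 3 ≤ j → Covers H i j) → LinearForest H
  covers⇒linearForest cov = lineEmbedding⇒linearForest H
    (covers⇒lineEmbedding H (cov 3 3 ≤-refl ≤-refl) (cov 4 4 (n≤1+n 3) (n≤1+n 3)))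
  linearForest⇒covers-all : LinearForest H → (i j : ℕ) → 3 ≤ i → 3 ≤ j → Covers H i j
  linearForest⇒covers-all lf i j _ 3≤j = linearForest⇒covers H lf i j (<-≤-trans (s≤s z≤n) 3≤j)
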